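{- Let $s,t\ge 1$ be integers, let $q\neq -1$ be a scalar, and let $\mathscr{D}(K_{s,t})$ be the $q$-distance matrix of the complete bipartite graph $K_{s,t}$. Then $$\det(\mathscr{D}(K_{s,t}))=(-1)^{s+t-2}(q+1)^{s+t-2}\left[(q+1)^2(s-1)(t-1)-st\right].$$
   Context: $q$ is a real or complex number (the paper calls it an indeterminate). For an integer $\alpha\ge 1$ put $[\alpha]=1+q+\cdots+q^{\alpha-1}$, and $[0]=0$. For a connected graph $G$ with vertices $v_1,\dots,v_N$ and shortest-path distance $d$, the $q$-distance matrix $\mathscr{D}(G)$ is the $N\times N$ matrix whose $(i,j)$ entry is $[d(v_i,v_j)]$ (so diagonal entries are $0$). $K_{s,t}$ is the complete bipartite graph with parts of sizes $s$ and $t$. -}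

module Defs where

open import Level using (Level)
open import Data.Nat using (ℕ; zero; suc; _<ᵇ_)
open import Data.Bool using (Bool; true; false; if_then_else_)
open import Data.Fin using (Fin; zero; suc; toℕ; punchIn; _≟_)
open import Relation.Nullary using (yes; no)
open import Algebra.Bundles using (CommutativeRing)

-- Two distinct vertices in different parts are adjacent (distance 1);
-- two distinct vertices in the same part have a common neighbour in the
-- other part (distance 2, given both parts are nonempty).
inFirstPart : (s : ℕ) {n : ℕ} → Fin n → Bool
inFirstPart s i = toℕ i <ᵇ s

sameBool : Bool → Bool → Bool
sameBool true  true  = true
sameBool false false = true
sameBool _     _     = false

distK : (s t : ℕ) → Fin (s Data.Nat.+ t) → Fin (s Data.Nat.+ t) → ℕ
distK s t i j with i ≟ j
... | yes _ = 0
... | no  _ = if sameBool (inFirstPart s i) (inFirstPart s j) then 2 else 1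

module _ {c ℓ : Level} (R : CommutativeRing c ℓ) where
  open CommutativeRing R using (Carrier; _+_; _*_; -_; 0#; 1#)

  qint : Carrier → ℕ → Carrier
  qint q zero    = 0#
  qint q (suc a) = 1# + q * qint q a

  pow : Carrier → ℕ → Carrier
  pow x zero    = 1#
  pow x (suc n) = x * pow x n

  fromℕ : ℕ → Carrier
  fromℕ zero    = 0#
  fromℕ (suc n) = 1# + fromℕ n

  sumFin : (n : ℕ) → (Fin n → Carrier) → Carrier
  sumFin zero    f = 0#
  sumFin (suc n) f = f zero + sumFin n (λ i → f (suc i))

  det : (n : ℕ) → (Fin n → Fin n → Carrier) → Carrier
  det zero    M = 1#
  det (suc n) M =
    sumFin (suc n) (λ j →
      pow (- 1#) (toℕ j) * M zero j
        * det n (λ a b → M (suc a) (punchIn j b)))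

  qDistMatrix : (N : ℕ) → (Fin N → Fin N → ℕ) → Carrier → Fin N → Fin N → Carrier
  qDistMatrix N d q i j = qint q (d i j)

  qDistK : (s t : ℕ) → Carrier → Fin (s Data.Nat.+ t) → Fin (s Data.Nat.+ t) → Carrier
  qDistK s t q = qDistMatrix (s Data.Nat.+ t) (distK s t) q

-- With p = [2] = q + 1 and δ = -p, the q-distance matrix of K_{s,t} is diag(δ) + B, where B has
-- entry p inside a part and 1 across the parts (the diagonal [0] = 0 is δ + p).  Splitting the row
-- of a vertex v as δ·e_v plus the rest gives det = δ·det(matrix without v) + det(δ at v replaced
-- by 0).  In the second matrix the row of v is its row of B, so the row of the next vertex w of the
-- same part exceeds it by δ·e_w, and that determinant is δ·det(matrix without w).  Running through
-- the first part and then through the second gives recurrences f(n+1) = δ f(n) + δ^(n+1) c, solved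
-- by f(n) = δ^n (f(0) + n c), and two 2×2 determinants finish the computation.

module Submission where

open import Defs
open import Level using (Level)
open import Data.Nat using (ℕ; _≤_; _∸_)
open import Algebra.Bundles using (CommutativeRing)
open import Relation.Nullary using (¬_)

open import Data.Nat as ℕ using (zero; suc)
import Data.Nat.Properties as ℕ
import Data.Integer.Properties as ℤ
open import Data.Integer as ℤ using (ℤ; +_; -[1+_]; _⊖_; _◃_; ∣_∣)
open import Data.Sign as Sign using (Sign)
open import Data.Maybe using (Maybe; just; nothing)
open import Relation.Nullary using (yes; no; does)
open import Relation.Nullary.Decidable using (dec-true; dec-false)
open import Data.Fin as Fin using (Fin; zero; suc; toℕ; punchIn; inject₁; _≟_)
import Data.Fin.Properties as Fin
open import Data.Bool using (Bool; true; false; if_then_else_)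
open import Function using (_∘_)
open import Data.Vec.Functional using (updateAt; _∷_)
open import Data.Vec.Functional.Properties using (updateAt-updates; updateAt-minimal)
open import Relation.Binary.PropositionalEquality as ≡ using (_≡_; _≢_)
open import Algebra.Solver.Ring.AlmostCommutativeRing
  using (fromCommutativeRing; _-Raw-AlmostCommutative⟶_)
import Algebra.Solver.Ring

module IntegerCoefficientSolver {c ℓ : Level} (R : CommutativeRing c ℓ) where
  open CommutativeRing R hiding (zero)
  open import Relation.Binary.Reasoning.Setoid setoid
  open import Algebra.Properties.Ring ring
    using (-‿involutive; -0#≈0#; -‿distribˡ-*; -‿distribʳ-*)
  open import Algebra.Properties.AbelianGroup +-abelianGroup using (⁻¹-∙-comm; xyx⁻¹≈y)
  open import Algebra.Properties.Semiring.Mult.TCOptimised semiring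
    using (_×_; 1+×; ×-homo-+; ×1-homo-*)

  signed : Sign → Carrier → Carrier
  signed Sign.+ x = x
  signed Sign.- x = - x

  signed-cong : ∀ s {x y} → x ≈ y → signed s x ≈ signed s y
  signed-cong Sign.+ x≈y = x≈y
  signed-cong Sign.- x≈y = -‿cong x≈y

  signed-* : ∀ s t x y → signed (s Sign.* t) (x * y) ≈ signed s x * signed t y
  signed-* Sign.+ Sign.+ x y = refl
  signed-* Sign.+ Sign.- x y = -‿distribʳ-* x y
  signed-* Sign.- Sign.+ x y = -‿distribˡ-* x y
  signed-* Sign.- Sign.- x y = begin
    x * y       ≈⟨ -‿involutive (x * y) ⟨
    - - (x * y) ≈⟨ -‿cong (-‿distribˡ-* x y) ⟩
    - (- x * y) ≈⟨ -‿distribʳ-* (- x) y ⟩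
    - x * - y   ∎

  -- The optimised _×_ makes ⟦ + 1 ⟧ℤ and ⟦ -[1+ 0 ] ⟧ℤ reduce to 1# and - 1#, so the constants of a
  -- solver problem match those of the goal definitionally.
  ⟦_⟧ℤ : ℤ → Carrier
  ⟦ i ⟧ℤ = signed (ℤ.sign i) (∣ i ∣ × 1#)

  ◃-homo : ∀ s n → ⟦ s ◃ n ⟧ℤ ≈ signed s (n × 1#)
  ◃-homo Sign.+ zero    = refl
  ◃-homo Sign.- zero    = sym -0#≈0#
  ◃-homo Sign.+ (suc n) = refl
  ◃-homo Sign.- (suc n) = refl

  *-homo : ∀ i j → ⟦ i ℤ.* j ⟧ℤ ≈ ⟦ i ⟧ℤ * ⟦ j ⟧ℤ
  *-homo i j = begin
    ⟦ i ℤ.* j ⟧ℤ                             ≈⟨ ◃-homo σ (∣ i ∣ ℕ.* ∣ j ∣) ⟩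
    signed σ ((∣ i ∣ ℕ.* ∣ j ∣) × 1#)        ≈⟨ signed-cong σ (×1-homo-* ∣ i ∣ ∣ j ∣) ⟩
    signed σ ((∣ i ∣ × 1#) * (∣ j ∣ × 1#))   ≈⟨ signed-* (ℤ.sign i) (ℤ.sign j) _ _ ⟩
    ⟦ i ⟧ℤ * ⟦ j ⟧ℤ                          ∎
    where σ = ℤ.sign i Sign.* ℤ.sign j

  ⊖-homo : ∀ m n → ⟦ m ⊖ n ⟧ℤ ≈ m × 1# - n × 1#
  ⊖-homo zero    zero    = sym (-‿inverseʳ 0#)
  ⊖-homo zero    (suc n) = sym (+-identityˡ _)
  ⊖-homo (suc m) zero    = sym (trans (+-congˡ -0#≈0#) (+-identityʳ _))
  ⊖-homo (suc m) (suc n) = begin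
    ⟦ suc m ⊖ suc n ⟧ℤ        ≡⟨ ≡.cong ⟦_⟧ℤ (ℤ.[1+m]⊖[1+n]≡m⊖n m n) ⟩
    ⟦ m ⊖ n ⟧ℤ                ≈⟨ ⊖-homo m n ⟩
    a - b                     ≈⟨ xyx⁻¹≈y 1# (a - b) ⟨
    1# + (a - b) - 1#         ≈⟨ +-congʳ (+-assoc 1# a (- b)) ⟨
    1# + a - b - 1#           ≈⟨ +-assoc (1# + a) (- b) (- 1#) ⟩
    1# + a + (- b - 1#)       ≈⟨ +-congˡ (+-comm (- b) (- 1#)) ⟩
    1# + a + (- 1# - b)       ≈⟨ +-congˡ (⁻¹-∙-comm 1# b) ⟩
    1# + a - (1# + b)         ≈⟨ +-cong (1+× m 1#) (-‿cong (1+× n 1#)) ⟨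
    suc m × 1# - suc n × 1#   ∎
    where
    a = m × 1#
    b = n × 1#

  +-homo : ∀ i j → ⟦ i ℤ.+ j ⟧ℤ ≈ ⟦ i ⟧ℤ + ⟦ j ⟧ℤ
  +-homo -[1+ m ] -[1+ n ] = begin
    - (suc (suc (m ℕ.+ n)) × 1#)      ≡⟨ ≡.cong (λ k → - (suc k × 1#)) (ℕ.+-suc m n) ⟨
    - ((suc m ℕ.+ suc n) × 1#)        ≈⟨ -‿cong (×-homo-+ 1# (suc m) (suc n)) ⟩
    - (suc m × 1# + suc n × 1#)       ≈⟨ ⁻¹-∙-comm _ _ ⟨
    - (suc m × 1#) + - (suc n × 1#)   ∎
  +-homo -[1+ m ] (+ n)    = trans (⊖-homo n (suc m)) (+-comm _ _)
  +-homo (+ m)    -[1+ n ] = ⊖-homo m (suc n)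
  +-homo (+ m)    (+ n)    = ×-homo-+ 1# m n

  -‿homo : ∀ i → ⟦ ℤ.- i ⟧ℤ ≈ - ⟦ i ⟧ℤ
  -‿homo -[1+ n ]    = sym (-‿involutive _)
  -‿homo (+ zero)    = sym -0#≈0#
  -‿homo (+ (suc n)) = refl

  ℤ⟶R : ℤ.+-*-rawRing -Raw-AlmostCommutative⟶ fromCommutativeRing R
  ℤ⟶R = record
    { ⟦_⟧ = ⟦_⟧ℤ ; +-homo = +-homo ; *-homo = *-homo ; -‿homo = -‿homo
    ; 0-homo = refl ; 1-homo = refl }

  ⟦⟧ℤ-equal? : ∀ i j → Maybe (⟦ i ⟧ℤ ≈ ⟦ j ⟧ℤ)
  ⟦⟧ℤ-equal? i j with i ℤ.≟ j
  ... | yes ≡.refl = just refl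
  ... | no _       = nothing

  open Algebra.Solver.Ring ℤ.+-*-rawRing (fromCommutativeRing R) ℤ⟶R ⟦⟧ℤ-equal? public
    using (solve; _:=_; _:+_; _:*_; :-_; _:-_; con)

module Determinant {c ℓ : Level} (R : CommutativeRing c ℓ) where
  open CommutativeRing R hiding (zero)
  open IntegerCoefficientSolver R
  open import Algebra.Properties.Ring ring using (-1*x≈-x; -‿distribʳ-*; -‿involutive)
  open import Algebra.Properties.AbelianGroup +-abelianGroup using (⁻¹-∙-comm)
  open import Relation.Binary.Reasoning.Setoid setoid
  open import Algebra.Properties.Semiring.Sum semiring
    using ( sum; sum-syntax; ∑-distrib-+; ∑-comm; *-distribˡ-sum
          ; sum-cong-≋; sum-cong-≗; sum-replicate-zero; sum-remove)

  Matrix : ℕ → Set c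
  Matrix n = Fin n → Fin n → Carrier

  minor : ∀ {n} → Fin (suc n) → Fin (suc n) → Matrix (suc n) → Matrix n
  minor i j M a b = M (punchIn i a) (punchIn j b)

  sign : ℕ → Carrier
  sign = pow R (- 1#)

  sign-suc : ∀ k x → sign (suc k) * x ≈ - (sign k * x)
  sign-suc k x = solve 2 (λ s x → (:- con (+ 1) :* s) :* x := :- (s :* x)) refl (sign k) x

  sign-sq : ∀ k → sign k * sign k ≈ 1#
  sign-sq zero    = *-identityʳ 1#
  sign-sq (suc k) = trans (solve 1 (λ s → (:- con (+ 1) :* s) :* (:- con (+ 1) :* s) := s :* s) refl (sign k))
                          (sign-sq k)

  sum-zero : ∀ {n} (f : Fin n → Carrier) → (∀ i → f i ≈ 0#) → sum f ≈ 0#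
  sum-zero {n} f f≈0 = trans (sum-cong-≋ f≈0) (sum-replicate-zero n)

  sum-single : ∀ {n} (r : Fin (suc n)) (f : Fin (suc n) → Carrier) →
    (∀ i → i ≢ r → f i ≈ 0#) → sum f ≈ f r
  sum-single r f f≈0 = begin
    sum f                       ≈⟨ sum-remove f ⟩
    f r + sum (f ∘ punchIn r)   ≈⟨ +-congˡ (sum-zero _ (λ i → f≈0 (punchIn r i) (Fin.punchInᵢ≢i r i))) ⟩
    f r + 0#                    ≈⟨ +-identityʳ (f r) ⟩
    f r                         ∎

  sum-neg : ∀ {n} (f : Fin n → Carrier) → sum (λ i → - f i) ≈ - sum f
  sum-neg {n} f = begin
    sum (λ i → - f i)        ≈⟨ sum-cong-≋ {n} (λ i → -1*x≈-x (f i)) ⟨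
    sum (λ i → - 1# * f i)   ≈⟨ *-distribˡ-sum (- 1#) f ⟨
    - 1# * sum f             ≈⟨ -1*x≈-x (sum f) ⟩
    - sum f                  ∎

  sumFin≡sum : ∀ n (f : Fin n → Carrier) → sumFin R n f ≡ sum f
  sumFin≡sum zero    f = ≡.refl
  sumFin≡sum (suc n) f = ≡.cong (_+_ (f zero)) (sumFin≡sum n (f ∘ suc))

  rowExpansion : ∀ {n} → Fin (suc n) → Matrix (suc n) → Carrier
  rowExpansion {n} r M = sum (λ j → sign (toℕ j) * M r j * det R n (minor r j M))

  firstColumnTerm : ∀ {n} → Matrix (suc n) → Fin (suc n) → Carrier
  firstColumnTerm {n} M i = sign (toℕ i) * M i zero * det R n (minor i zero M)

  det≡firstRowExpansion : ∀ {n} (M : Matrix (suc n)) → det R (suc n) M ≡ rowExpansion zero M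
  det≡firstRowExpansion {n} M =
    sumFin≡sum (suc n) (λ j → sign (toℕ j) * M zero j * det R n (minor zero j M))

  det-cong : ∀ n {M N : Matrix n} → (∀ i j → M i j ≈ N i j) → det R n M ≈ det R n N
  det-cong zero    M≈N = refl
  det-cong (suc n) {M} {N} M≈N = begin
    det R (suc n) M       ≡⟨ det≡firstRowExpansion M ⟩
    rowExpansion zero M   ≈⟨ sum-cong-≋ (λ j → *-cong (*-congˡ {sign (toℕ j)} (M≈N zero j))
                                                     (det-cong n (λ a b → M≈N (suc a) (punchIn j b)))) ⟩
    rowExpansion zero N   ≡⟨ det≡firstRowExpansion N ⟨
    det R (suc n) N       ∎

  det≈firstColumnExpansion : ∀ {n} (M : Matrix (suc n)) → det R (suc n) M ≈ sum (firstColumnTerm M)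
  det≈firstColumnExpansion {zero}  M = refl
  det≈firstColumnExpansion {suc n} M = begin
    det R (suc (suc n)) M
      ≡⟨ det≡firstRowExpansion M ⟩
    T zero + ∑[ j < suc n ] (a j * det R (suc n) (minor zero (suc j) M))
      ≈⟨ +-congˡ (sum-cong-≋ {suc n} λ j → *-congˡ {a j} (det≈firstColumnExpansion (minor zero (suc j) M))) ⟩
    T zero + ∑[ j < suc n ] (a j * ∑[ i < suc n ] (u i j))
      ≈⟨ +-congˡ (sum-cong-≋ {suc n} λ j → *-distribˡ-sum {suc n} (a j) (λ i → u i j)) ⟩
    T zero + ∑[ j < suc n ] ∑[ i < suc n ] (a j * u i j)
      ≈⟨ +-congˡ (∑-comm {suc n} {suc n} λ j i → a j * u i j) ⟩
    T zero + ∑[ i < suc n ] ∑[ j < suc n ] (a j * u i j)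
      ≈⟨ +-congˡ (sum-cong-≋ {suc n} λ i → sum-cong-≋ {suc n} λ j →
           exchange (sign (toℕ j)) (A j) (sign (toℕ i)) (B i) (X i j)) ⟩
    T zero + ∑[ i < suc n ] ∑[ j < suc n ] (b i * v i j)
      ≈⟨ +-congˡ (sum-cong-≋ {suc n} λ i → *-distribˡ-sum {suc n} (b i) (v i)) ⟨
    T zero + ∑[ i < suc n ] (b i * rowExpansion zero (minor (suc i) zero M))
      ≡⟨ ≡.cong (_+_ (T zero)) (sum-cong-≗ λ i →
           ≡.cong (_*_ (b i)) (≡.sym (det≡firstRowExpansion (minor (suc i) zero M)))) ⟩
    sum (firstColumnTerm M)
      ∎
    where
    T = firstColumnTerm M
    A B a b : Fin (suc n) → Carrier
    A j = M zero (suc j)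
    B i = M (suc i) zero
    a j = sign (suc (toℕ j)) * A j
    b i = sign (suc (toℕ i)) * B i
    X u v : Fin (suc n) → Fin (suc n) → Carrier
    X i j = det R n (λ a b → M (suc (punchIn i a)) (suc (punchIn j b)))
    u i j = sign (toℕ i) * B i * X i j
    v i j = sign (toℕ j) * A j * X i j
    exchange : ∀ sⱼ Aⱼ sᵢ Bᵢ x →
      (- 1# * sⱼ) * Aⱼ * (sᵢ * Bᵢ * x) ≈ (- 1# * sᵢ) * Bᵢ * (sⱼ * Aⱼ * x)
    exchange = solve 5 (λ sⱼ Aⱼ sᵢ Bᵢ x →
      (:- con (+ 1) :* sⱼ) :* Aⱼ :* (sᵢ :* Bᵢ :* x) := (:- con (+ 1) :* sᵢ) :* Bᵢ :* (sⱼ :* Aⱼ :* x)) refl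

  det-equalFirstRows : ∀ n (M : Matrix (suc (suc n))) → (∀ j → M zero j ≈ M (suc zero) j) →
    det R (suc (suc n)) M ≈ 0#
  det-equalFirstRows n M eq = begin
    det R (suc (suc n)) M                                         ≈⟨ det≈firstColumnExpansion M ⟩
    C M zero + (C M (suc zero) + ∑[ i < n ] C M (suc (suc i)))    ≈⟨ +-assoc _ _ _ ⟨
    C M zero + C M (suc zero) + ∑[ i < n ] C M (suc (suc i))      ≈⟨ +-cong cancel (sum-zero {n} _ (lower M eq)) ⟩
    0# + 0#                                                       ≈⟨ +-identityʳ 0# ⟩
    0#                                                            ∎
    where
    C = firstColumnTerm
    sameMinor : ∀ a b → minor zero zero M a b ≈ minor (suc zero) zero M a b
    sameMinor zero    b = sym (eq (suc b))
    sameMinor (suc a) b = refl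
    cancel : C M zero + C M (suc zero) ≈ 0#
    cancel = begin
      C M zero + C M (suc zero)
        ≈⟨ +-congʳ (*-cong (*-congˡ (eq zero)) (det-cong (suc n) sameMinor)) ⟩
      1# * M (suc zero) zero * d + (- 1# * 1#) * M (suc zero) zero * d
        ≈⟨ solve 2 (λ x d → con (+ 1) :* x :* d :+ (:- con (+ 1) :* con (+ 1)) :* x :* d := con (+ 0))
                 refl (M (suc zero) zero) d ⟩
      0# ∎
      where d = det R (suc n) (minor (suc zero) zero M)
    lower : ∀ {m} (N : Matrix (suc (suc m))) → (∀ j → N zero j ≈ N (suc zero) j) →
      ∀ i → C N (suc (suc i)) ≈ 0#
    lower {suc m} N eqN i =
      trans (*-congˡ (det-equalFirstRows m (minor (suc (suc i)) zero N) (λ j → eqN (suc j)))) (zeroʳ _)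

  swapAdjacent : ∀ {n} → Fin n → Fin (suc n) → Fin (suc n)
  swapAdjacent zero    zero          = suc zero
  swapAdjacent zero    (suc zero)    = zero
  swapAdjacent zero    (suc (suc i)) = suc (suc i)
  swapAdjacent (suc k) zero          = zero
  swapAdjacent (suc k) (suc i)       = suc (swapAdjacent k i)

  swapAdjacent-inject₁ : ∀ {n} (k : Fin n) → swapAdjacent k (inject₁ k) ≡ suc k
  swapAdjacent-inject₁ zero    = ≡.refl
  swapAdjacent-inject₁ (suc k) = ≡.cong suc (swapAdjacent-inject₁ k)

  swapAdjacent-punchIn : ∀ {n} (k a : Fin n) → swapAdjacent k (punchIn (inject₁ k) a) ≡ punchIn (suc k) a
  swapAdjacent-punchIn zero    zero    = ≡.refl
  swapAdjacent-punchIn zero    (suc a) = ≡.refl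
  swapAdjacent-punchIn (suc k) zero    = ≡.refl
  swapAdjacent-punchIn (suc k) (suc a) = ≡.cong suc (swapAdjacent-punchIn k a)

  det-swapFirstRows : ∀ n (M : Matrix (suc (suc n))) →
    det R (suc (suc n)) (M ∘ swapAdjacent zero) ≈ - det R (suc (suc n)) M
  det-swapFirstRows n M = begin
    det R (suc (suc n)) N
      ≈⟨ det≈firstColumnExpansion N ⟩
    C N zero + (C N (suc zero) + ∑[ i < n ] C N (suc (suc i)))
      ≈⟨ +-assoc _ _ _ ⟨
    C N zero + C N (suc zero) + ∑[ i < n ] C N (suc (suc i))
      ≈⟨ +-cong firstTwo (sum-cong-≋ {n} (lower M)) ⟩
    - (C M zero + C M (suc zero)) + ∑[ i < n ] (- C M (suc (suc i)))
      ≈⟨ +-congˡ (sum-neg {n} (λ i → C M (suc (suc i)))) ⟩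
    - (C M zero + C M (suc zero)) + - ∑[ i < n ] C M (suc (suc i))
      ≈⟨ ⁻¹-∙-comm _ _ ⟩
    - (C M zero + C M (suc zero) + ∑[ i < n ] C M (suc (suc i)))
      ≈⟨ -‿cong (+-assoc _ _ _) ⟩
    - sum (firstColumnTerm M)
      ≈⟨ -‿cong (det≈firstColumnExpansion M) ⟨
    - det R (suc (suc n)) M
      ∎
    where
    N = M ∘ swapAdjacent zero
    C = firstColumnTerm
    minor₀ : ∀ a b → minor zero zero N a b ≈ minor (suc zero) zero M a b
    minor₀ zero    b = refl
    minor₀ (suc a) b = refl
    minor₁ : ∀ a b → minor (suc zero) zero N a b ≈ minor zero zero M a b
    minor₁ zero    b = refl
    minor₁ (suc a) b = refl
    firstTwo : C N zero + C N (suc zero) ≈ - (C M zero + C M (suc zero))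
    firstTwo = begin
      C N zero + C N (suc zero)
        ≈⟨ +-cong (*-congˡ (det-cong (suc n) minor₀)) (*-congˡ (det-cong (suc n) minor₁)) ⟩
      1# * x₁ * d₁ + (- 1# * 1#) * x₀ * d₀
        ≈⟨ solve 4 (λ x₀ x₁ d₀ d₁ →
                 con (+ 1) :* x₁ :* d₁ :+ (:- con (+ 1) :* con (+ 1)) :* x₀ :* d₀
                 := :- (con (+ 1) :* x₀ :* d₀ :+ (:- con (+ 1) :* con (+ 1)) :* x₁ :* d₁))
               refl x₀ x₁ d₀ d₁ ⟩
      - (C M zero + C M (suc zero)) ∎
      where
      x₀ = M zero zero
      x₁ = M (suc zero) zero
      d₀ = det R (suc n) (minor zero zero M)
      d₁ = det R (suc n) (minor (suc zero) zero M)
    lower : ∀ {m} (P : Matrix (suc (suc m))) (i : Fin m) →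
      C (P ∘ swapAdjacent zero) (suc (suc i)) ≈ - C P (suc (suc i))
    lower {suc m} P i = begin
      s * x * det R (suc (suc m)) (minor (suc (suc i)) zero (P ∘ swapAdjacent zero))
        ≈⟨ *-congˡ (det-cong (suc (suc m)) swapped) ⟩
      s * x * det R (suc (suc m)) (minor (suc (suc i)) zero P ∘ swapAdjacent zero)
        ≈⟨ *-congˡ (det-swapFirstRows m (minor (suc (suc i)) zero P)) ⟩
      s * x * - det R (suc (suc m)) (minor (suc (suc i)) zero P)
        ≈⟨ -‿distribʳ-* _ _ ⟨
      - C P (suc (suc i)) ∎
      where
      s = sign (toℕ (suc (suc i)))
      x = P (suc (suc i)) zero
      swapped : ∀ a b → minor (suc (suc i)) zero (P ∘ swapAdjacent zero) a b
                      ≈ (minor (suc (suc i)) zero P ∘ swapAdjacent zero) a b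
      swapped zero          b = refl
      swapped (suc zero)    b = refl
      swapped (suc (suc a)) b = refl

  det-equalAdjacentRows : ∀ n (k : Fin n) (M : Matrix (suc n)) →
    (∀ j → M (inject₁ k) j ≈ M (suc k) j) → det R (suc n) M ≈ 0#
  det-equalAdjacentRows (suc n) zero    M eq = det-equalFirstRows n M eq
  det-equalAdjacentRows (suc n) (suc k) M eq = begin
    det R (suc (suc n)) M   ≡⟨ det≡firstRowExpansion M ⟩
    rowExpansion zero M     ≈⟨ sum-zero {suc (suc n)} _ term≈0 ⟩
    0#                      ∎
    where
    term≈0 : ∀ j → sign (toℕ j) * M zero j * det R (suc n) (minor zero j M) ≈ 0#
    term≈0 j = trans (*-congˡ (det-equalAdjacentRows n k (minor zero j M) (λ b → eq (punchIn j b)))) (zeroʳ _)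

  det-swapAdjacentRows : ∀ n (k : Fin n) (M : Matrix (suc n)) →
    det R (suc n) (M ∘ swapAdjacent k) ≈ - det R (suc n) M
  det-swapAdjacentRows (suc n) zero    M = det-swapFirstRows n M
  det-swapAdjacentRows (suc n) (suc k) M = begin
    det R (suc (suc n)) (M ∘ swapAdjacent (suc k))
      ≡⟨ det≡firstRowExpansion (M ∘ swapAdjacent (suc k)) ⟩
    ∑[ j < suc (suc n) ] (T j * det R (suc n) (minor zero j M ∘ swapAdjacent k))
      ≈⟨ sum-cong-≋ {suc (suc n)} (λ j → *-congˡ {T j} (det-swapAdjacentRows n k (minor zero j M))) ⟩
    ∑[ j < suc (suc n) ] (T j * - det R (suc n) (minor zero j M))
      ≈⟨ sum-cong-≋ {suc (suc n)} (λ j → -‿distribʳ-* (T j) (det R (suc n) (minor zero j M))) ⟨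
    ∑[ j < suc (suc n) ] (- (T j * det R (suc n) (minor zero j M)))
      ≈⟨ sum-neg {suc (suc n)} (λ j → T j * det R (suc n) (minor zero j M)) ⟩
    - rowExpansion zero M
      ≡⟨ ≡.cong -_ (det≡firstRowExpansion M) ⟨
    - det R (suc (suc n)) M ∎
    where
    T : Fin (suc (suc n)) → Carrier
    T j = sign (toℕ j) * M zero j

  det≈rowExpansion : ∀ {n} (r : Fin (suc n)) (M : Matrix (suc n)) →
    det R (suc n) M ≈ sign (toℕ r) * rowExpansion r M
  det≈rowExpansion r = expand (toℕ r) r ≡.refl
    where
    -- Indexed by k = toℕ r, so that the recursive call on the row inject₁ r is structural.
    expand : ∀ k {n} (r : Fin (suc n)) → toℕ r ≡ k → (M : Matrix (suc n)) →
      det R (suc n) M ≈ sign k * rowExpansion r M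
    expand zero    zero    _ M = trans (reflexive (det≡firstRowExpansion M)) (sym (*-identityˡ _))
    expand (suc k) {suc n} (suc r) eq M = begin
      det R (suc (suc n)) M                      ≈⟨ -‿involutive _ ⟨
      - - det R (suc (suc n)) M                  ≈⟨ -‿cong (det-swapAdjacentRows (suc n) r M) ⟨
      - det R (suc (suc n)) M′                   ≈⟨ -‿cong (expand k (inject₁ r) toℕ-inject₁r≡k M′) ⟩
      - (sign k * rowExpansion (inject₁ r) M′)   ≈⟨ -‿cong (*-congˡ (sum-cong-≋ {suc (suc n)} swapped)) ⟩
      - (sign k * rowExpansion (suc r) M)        ≈⟨ sign-suc k _ ⟨
      sign (suc k) * rowExpansion (suc r) M      ∎
      where
      M′ = M ∘ swapAdjacent r
      toℕ-inject₁r≡k : toℕ (inject₁ r) ≡ k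
      toℕ-inject₁r≡k = ≡.trans (Fin.toℕ-inject₁ r) (ℕ.suc-injective eq)
      swapped : ∀ j → sign (toℕ j) * M′ (inject₁ r) j * det R (suc n) (minor (inject₁ r) j M′)
                    ≈ sign (toℕ j) * M (suc r) j * det R (suc n) (minor (suc r) j M)
      swapped j = *-cong (*-congˡ (reflexive (≡.cong (λ i → M i j) (swapAdjacent-inject₁ r))))
                         (det-cong (suc n) λ a b →
                           reflexive (≡.cong (λ i → M i (punchIn j b)) (swapAdjacent-punchIn r a)))

  det-splitRow : ∀ {n} (r : Fin (suc n)) (x : Carrier) (M M′ : Matrix (suc n)) →
    (∀ i j → i ≢ r → M i j ≈ M′ i j) →
    (∀ j → M r j ≈ (if does (r ≟ j) then x else 0#) + M′ r j) →
    det R (suc n) M ≈ x * det R n (minor r r M) + det R (suc n) M′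
  det-splitRow {n} r x M M′ M≈M′ Mr≈ = begin
    det R (suc n) M
      ≈⟨ det≈rowExpansion r M ⟩
    s r * rowExpansion r M
      ≈⟨ *-congˡ (sum-cong-≋ {suc n} split) ⟩
    s r * ∑[ j < suc n ] (E j + s j * M′ r j * D′ j)
      ≈⟨ *-congˡ (∑-distrib-+ {suc n} E (λ j → s j * M′ r j * D′ j)) ⟩
    s r * (∑[ j < suc n ] E j + rowExpansion r M′)
      ≈⟨ *-congˡ (+-congʳ (sum-single r E offDiagonal)) ⟩
    s r * (s r * e r * D′ r + rowExpansion r M′)
      ≈⟨ solve 4 (λ s x d y → s :* (s :* x :* d :+ y) := s :* s :* x :* d :+ s :* y)
               refl (s r) (e r) (D′ r) (rowExpansion r M′) ⟩
    s r * s r * e r * D′ r + s r * rowExpansion r M′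
      ≈⟨ +-cong (*-congʳ (sym (trans (*-congʳ (sign-sq (toℕ r))) (*-identityˡ (e r)))))
                (det≈rowExpansion r M′) ⟨
    e r * D′ r + det R (suc n) M′
      ≡⟨ ≡.cong (λ y → y * D′ r + det R (suc n) M′) eᵣ≡x ⟩
    x * D′ r + det R (suc n) M′
      ≈⟨ +-congʳ (*-congˡ (det-cong n (λ a b → sym (sameMinor r a b)))) ⟩
    x * det R n (minor r r M) + det R (suc n) M′
      ∎
    where
    s : ∀ {m} → Fin m → Carrier
    s j = sign (toℕ j)
    e D′ E : Fin (suc n) → Carrier
    e j = if does (r ≟ j) then x else 0#
    D′ j = det R n (minor r j M′)
    E j = s j * e j * D′ j
    eᵣ≡x : e r ≡ x
    eᵣ≡x = ≡.cong (if_then x else 0#) (dec-true (r ≟ r) ≡.refl)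
    sameMinor : ∀ j a b → minor r j M a b ≈ minor r j M′ a b
    sameMinor j a b = M≈M′ (punchIn r a) (punchIn j b) (Fin.punchInᵢ≢i r a)
    split : ∀ j → s j * M r j * det R n (minor r j M) ≈ E j + s j * M′ r j * D′ j
    split j = begin
      s j * M r j * det R n (minor r j M)      ≈⟨ *-cong (*-congˡ (Mr≈ j)) (det-cong n (sameMinor j)) ⟩
      s j * (e j + M′ r j) * D′ j              ≈⟨ *-congʳ (distribˡ (s j) (e j) (M′ r j)) ⟩
      (s j * e j + s j * M′ r j) * D′ j        ≈⟨ distribʳ (D′ j) (s j * e j) (s j * M′ r j) ⟩
      E j + s j * M′ r j * D′ j                ∎
    offDiagonal : ∀ j → j ≢ r → E j ≈ 0#
    offDiagonal j j≢r = begin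
      s j * e j * D′ j
        ≡⟨ ≡.cong (λ b → s j * (if b then x else 0#) * D′ j) (dec-false (r ≟ j) (j≢r ∘ ≡.sym)) ⟩
      s j * 0# * D′ j
        ≈⟨ trans (*-congʳ (zeroʳ (s j))) (zeroˡ (D′ j)) ⟩
      0# ∎

  det-2×2 : (M : Matrix 2) →
    det R 2 M ≈ M zero zero * M (suc zero) (suc zero) - M zero (suc zero) * M (suc zero) zero
  det-2×2 M = solve 4 (λ a b c d →
      con (+ 1) :* a :* (con (+ 1) :* d :* con (+ 1) :+ con (+ 0))
        :+ ((:- con (+ 1) :* con (+ 1)) :* b :* (con (+ 1) :* c :* con (+ 1) :+ con (+ 0)) :+ con (+ 0))
      := a :* d :- b :* c)
    refl (M zero zero) (M zero (suc zero)) (M (suc zero) zero) (M (suc zero) (suc zero))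

module DiagonalPlusMatrix {c ℓ : Level} (R : CommutativeRing c ℓ) where
  open CommutativeRing R hiding (zero)
  open Determinant R
  open import Relation.Binary.Reasoning.Setoid setoid

  diagonal : ∀ {n} → (Fin n → Carrier) → Matrix n
  diagonal d i j = if does (i ≟ j) then d i else 0#

  _+ᴹ_ : ∀ {n} → Matrix n → Matrix n → Matrix n
  (M +ᴹ N) i j = M i j + N i j

  private
    if-cong : ∀ b {x y} → x ≈ y → (if b then x else 0#) ≈ (if b then y else 0#)
    if-cong true  x≈y = x≈y
    if-cong false _   = refl

    if-zero : ∀ b {x} → x ≈ 0# → (if b then x else 0#) ≈ 0#
    if-zero true  x≈0 = x≈0
    if-zero false _   = refl

  diagonal-congʳ : ∀ {n} (d d′ : Fin n → Carrier) i → d i ≈ d′ i →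
    ∀ j → diagonal d i j ≈ diagonal d′ i j
  diagonal-congʳ d d′ i di≈d′i j = if-cong (does (i ≟ j)) di≈d′i

  does-punchIn : ∀ {n} (r : Fin (suc n)) (a b : Fin n) →
    does (punchIn r a ≟ punchIn r b) ≡ does (a ≟ b)
  does-punchIn r a b with a ≟ b
  ... | yes ≡.refl = dec-true (punchIn r a ≟ punchIn r a) ≡.refl
  ... | no  a≢b    = dec-false (punchIn r a ≟ punchIn r b) (a≢b ∘ Fin.punchIn-injective r a b)

  minor-diagonal : ∀ {n} (r : Fin (suc n)) (d : Fin (suc n) → Carrier) a b →
    minor r r (diagonal d) a b ≡ diagonal (d ∘ punchIn r) a b
  minor-diagonal r d a b = ≡.cong (if_then d (punchIn r a) else 0#) (does-punchIn r a b)

  det-diagonal+-cong : ∀ {n} (d d′ : Fin n → Carrier) (B B′ : Matrix n) →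
    (∀ i → d i ≈ d′ i) → (∀ i j → B i j ≈ B′ i j) →
    det R n (diagonal d +ᴹ B) ≈ det R n (diagonal d′ +ᴹ B′)
  det-diagonal+-cong {n} d d′ B B′ d≈d′ B≈B′ =
    det-cong n (λ i j → +-cong (diagonal-congʳ d d′ i (d≈d′ i) j) (B≈B′ i j))

  det-diagonal+-peel : ∀ {n} (r : Fin (suc n)) (d : Fin (suc n) → Carrier) (B : Matrix (suc n)) →
    det R (suc n) (diagonal d +ᴹ B)
      ≈ d r * det R n (diagonal (d ∘ punchIn r) +ᴹ minor r r B)
        + det R (suc n) (diagonal (updateAt d r (λ _ → 0#)) +ᴹ B)
  det-diagonal+-peel {n} r d B = begin
    det R (suc n) (diagonal d +ᴹ B)
      ≈⟨ det-splitRow r (d r) _ _ offRow onRow ⟩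
    d r * det R n (minor r r (diagonal d +ᴹ B)) + det R (suc n) (diagonal d′ +ᴹ B)
      ≈⟨ +-congʳ (*-congˡ (det-cong n (λ a b → +-congʳ (reflexive (minor-diagonal r d a b))))) ⟩
    d r * det R n (diagonal (d ∘ punchIn r) +ᴹ minor r r B) + det R (suc n) (diagonal d′ +ᴹ B)
      ∎
    where
    d′ = updateAt d r (λ _ → 0#)
    offRow : ∀ i j → i ≢ r → (diagonal d +ᴹ B) i j ≈ (diagonal d′ +ᴹ B) i j
    offRow i j i≢r =
      +-congʳ (diagonal-congʳ d d′ i (reflexive (≡.sym (updateAt-minimal i r {λ _ → 0#} d i≢r))) j)
    onRow : ∀ j → (diagonal d +ᴹ B) r j ≈ diagonal d r j + (diagonal d′ +ᴹ B) r j
    onRow j = +-congˡ (begin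
      B r j                     ≈⟨ +-identityˡ (B r j) ⟨
      0# + B r j                ≈⟨ +-congʳ (if-zero (does (r ≟ j)) d′r≈0) ⟨
      diagonal d′ r j + B r j   ∎)
      where d′r≈0 = reflexive (updateAt-updates r {λ _ → 0#} d)

  det-diagonal+-merge : ∀ {n} (k : Fin n) (d : Fin (suc n) → Carrier) (B : Matrix (suc n)) →
    d (inject₁ k) ≈ 0# → (∀ j → B (inject₁ k) j ≈ B (suc k) j) →
    det R (suc n) (diagonal d +ᴹ B)
      ≈ d (suc k) * det R n (diagonal (d ∘ punchIn (suc k)) +ᴹ minor (suc k) (suc k) B)
  det-diagonal+-merge {n} k d B dk≈0 sameRows = begin
    det R (suc n) (diagonal d +ᴹ B)
      ≈⟨ det-diagonal+-peel (suc k) d B ⟩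
    d (suc k) * D + det R (suc n) (diagonal d′ +ᴹ B)
      ≈⟨ +-congˡ (det-equalAdjacentRows n k (diagonal d′ +ᴹ B) equalRows) ⟩
    d (suc k) * D + 0#
      ≈⟨ +-identityʳ _ ⟩
    d (suc k) * D
      ∎
    where
    D = det R n (diagonal (d ∘ punchIn (suc k)) +ᴹ minor (suc k) (suc k) B)
    d′ = updateAt d (suc k) (λ _ → 0#)
    inject₁≢suc : inject₁ k ≢ suc k
    inject₁≢suc e = ℕ.1+n≢n (≡.trans (≡.sym (≡.cong toℕ e)) (Fin.toℕ-inject₁ k))
    d′k≈0 : d′ (inject₁ k) ≈ 0#
    d′k≈0 = trans (reflexive (updateAt-minimal (inject₁ k) (suc k) d inject₁≢suc)) dk≈0
    equalRows : ∀ j → (diagonal d′ +ᴹ B) (inject₁ k) j ≈ (diagonal d′ +ᴹ B) (suc k) j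
    equalRows j = begin
      diagonal d′ (inject₁ k) j + B (inject₁ k) j
        ≈⟨ +-cong (if-zero (does (inject₁ k ≟ j)) d′k≈0) (sameRows j) ⟩
      0# + B (suc k) j
        ≈⟨ +-congʳ (if-zero (does (suc k ≟ j)) (reflexive (updateAt-updates (suc k) {λ _ → 0#} d))) ⟨
      diagonal d′ (suc k) j + B (suc k) j ∎

module LinearRecurrence {c ℓ : Level} (R : CommutativeRing c ℓ) where
  open CommutativeRing R hiding (zero)
  open IntegerCoefficientSolver R
  open import Relation.Binary.Reasoning.Setoid setoid

  geometric-closedForm : ∀ (δ : Carrier) (g : ℕ → Carrier) → (∀ n → g (suc n) ≈ δ * g n) →
    ∀ n → g n ≈ pow R δ n * g 0
  geometric-closedForm δ g step zero    = sym (*-identityˡ (g 0))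
  geometric-closedForm δ g step (suc n) = begin
    g (suc n)               ≈⟨ step n ⟩
    δ * g n                 ≈⟨ *-congˡ (geometric-closedForm δ g step n) ⟩
    δ * (pow R δ n * g 0)   ≈⟨ *-assoc δ (pow R δ n) (g 0) ⟨
    pow R δ (suc n) * g 0   ∎

  geometricallyForced-closedForm : ∀ (δ : Carrier) (f g : ℕ → Carrier) →
    (∀ n → f (suc n) ≈ δ * f n + g (suc n)) → (∀ n → g (suc n) ≈ δ * g n) →
    ∀ n → f n ≈ pow R δ n * (f 0 + fromℕ R n * g 0)
  geometricallyForced-closedForm δ f g stepᶠ stepᵍ zero =
    solve 2 (λ a b → a := con (+ 1) :* (a :+ con (+ 0) :* b)) refl (f 0) (g 0)
  geometricallyForced-closedForm δ f g stepᶠ stepᵍ (suc n) = begin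
    f (suc n)
      ≈⟨ stepᶠ n ⟩
    δ * f n + g (suc n)
      ≈⟨ +-cong (*-congˡ (geometricallyForced-closedForm δ f g stepᶠ stepᵍ n))
                (geometric-closedForm δ g stepᵍ (suc n)) ⟩
    δ * (pow R δ n * (f 0 + fromℕ R n * g 0)) + δ * pow R δ n * g 0
      ≈⟨ solve 5 (λ δ P a m b →
                 δ :* (P :* (a :+ m :* b)) :+ δ :* P :* b := δ :* P :* (a :+ (con (+ 1) :+ m) :* b))
               refl δ (pow R δ n) (f 0) (fromℕ R n) (g 0) ⟩
    pow R δ (suc n) * (f 0 + fromℕ R (suc n) * g 0)
      ∎

module CompleteBipartite {c ℓ : Level} (R : CommutativeRing c ℓ) (q : CommutativeRing.Carrier R) where
  open CommutativeRing R hiding (zero)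
  open IntegerCoefficientSolver R
  open Determinant R
  open DiagonalPlusMatrix R
  open LinearRecurrence R
  open import Algebra.Properties.Ring ring using (-1*x≈-x)
  open import Algebra.Properties.CommutativeSemiring.Exp commutativeSemiring
    using (_^_; ^-congˡ; ^-homo-*; ^-distrib-*)
  open import Relation.Binary.Reasoning.Setoid setoid

  p δ : Carrier
  p = q + 1#
  δ = - p

  δs : ∀ {n} → Fin n → Carrier
  δs _ = δ

  blockOf : ∀ {n} → (Fin n → Bool) → Matrix n
  blockOf c i j = if sameBool (c i) (c j) then p else 1#

  minor-blockOf : ∀ {n} (r : Fin (suc n)) (c : Fin (suc n) → Bool) (c′ : Fin n → Bool) →
    (∀ a → c (punchIn r a) ≡ c′ a) → ∀ a b → minor r r (blockOf c) a b ≈ blockOf c′ a b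
  minor-blockOf r c c′ same a b =
    reflexive (≡.cong₂ (λ x y → if sameBool x y then p else 1#) (same a) (same b))

  detK : ∀ s t → (Fin (s ℕ.+ t) → Carrier) → Carrier
  detK s t d = det R (s ℕ.+ t) (diagonal d +ᴹ blockOf (inFirstPart s))

  detK-cong : ∀ s t (d d′ : Fin (s ℕ.+ t) → Carrier) → (∀ i → d i ≈ d′ i) → detK s t d ≈ detK s t d′
  detK-cong s t d d′ d≈d′ = det-diagonal+-cong d d′ B B d≈d′ (λ _ _ → refl)
    where B = blockOf (inFirstPart s)

  sameBool-refl : ∀ b → sameBool b b ≡ true
  sameBool-refl true  = ≡.refl
  sameBool-refl false = ≡.refl

  qDistK≈diagonal+block : ∀ s t (i j : Fin (s ℕ.+ t)) →
    qDistK R s t q i j ≈ (diagonal δs +ᴹ blockOf (inFirstPart s)) i j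
  qDistK≈diagonal+block s t i j with i ≟ j
  ... | yes ≡.refl rewrite sameBool-refl (inFirstPart s i) = sym (-‿inverseˡ p)
  ... | no  _ with sameBool (inFirstPart s i) (inFirstPart s j)
  ...   | true  = solve 1 (λ q → con (+ 1) :+ q :* (con (+ 1) :+ q :* con (+ 0))
                                 := con (+ 0) :+ (q :+ con (+ 1))) refl q
  ...   | false = solve 1 (λ q → con (+ 1) :+ q :* con (+ 0) := con (+ 0) :+ con (+ 1)) refl q

  detK-peelFirst : ∀ s t x (d : Fin (s ℕ.+ t) → Carrier) →
    detK (suc s) t (x ∷ d) ≈ x * detK s t d + detK (suc s) t (0# ∷ d)
  detK-peelFirst s t x d = begin
    detK (suc s) t (x ∷ d)
      ≈⟨ det-diagonal+-peel zero (x ∷ d) (blockOf (inFirstPart (suc s))) ⟩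
    x * detK s t d + detK (suc s) t d′
      ≈⟨ +-congˡ (detK-cong (suc s) t d′ (0# ∷ d) λ { zero → refl ; (suc i) → refl }) ⟩
    x * detK s t d + detK (suc s) t (0# ∷ d)
      ∎
    where d′ = updateAt (x ∷ d) zero (λ _ → 0#)

  detK-mergeFirst : ∀ s t y (d : Fin (s ℕ.+ t) → Carrier) →
    detK (suc (suc s)) t (0# ∷ y ∷ d) ≈ y * detK (suc s) t (0# ∷ d)
  detK-mergeFirst s t y d = begin
    detK (suc (suc s)) t (0# ∷ y ∷ d)
      ≈⟨ det-diagonal+-merge zero (0# ∷ y ∷ d) B refl (λ _ → refl) ⟩
    y * det R (suc s ℕ.+ t) (diagonal d′ +ᴹ minor (suc zero) (suc zero) B)
      ≈⟨ *-congˡ (det-diagonal+-cong d′ (0# ∷ d) (minor (suc zero) (suc zero) B) B′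
                   (λ { zero → refl ; (suc i) → refl })
                   (minor-blockOf (suc zero) (inFirstPart (suc (suc s))) (inFirstPart (suc s))
                     λ { zero → ≡.refl ; (suc a) → ≡.refl })) ⟩
    y * detK (suc s) t (0# ∷ d)
      ∎
    where
    B = blockOf (inFirstPart (suc (suc s)))
    B′ = blockOf (inFirstPart (suc s))
    d′ = (0# ∷ y ∷ d) ∘ punchIn (suc zero)

  detK-peelSecond : ∀ t x y (d : Fin t → Carrier) →
    detK 1 (suc t) (x ∷ y ∷ d) ≈ y * detK 1 t (x ∷ d) + detK 1 (suc t) (x ∷ 0# ∷ d)
  detK-peelSecond t x y d = begin
    detK 1 (suc t) (x ∷ y ∷ d)
      ≈⟨ det-diagonal+-peel (suc zero) (x ∷ y ∷ d) B ⟩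
    y * det R (suc t) (diagonal d′ +ᴹ minor (suc zero) (suc zero) B) + detK 1 (suc t) d₀
      ≈⟨ +-cong (*-congˡ (det-diagonal+-cong d′ (x ∷ d) (minor (suc zero) (suc zero) B) B
                            (λ { zero → refl ; (suc i) → refl })
                            (minor-blockOf (suc zero) (inFirstPart 1) (inFirstPart 1)
                              λ { zero → ≡.refl ; (suc a) → ≡.refl })))
                (detK-cong 1 (suc t) d₀ (x ∷ 0# ∷ d)
                   λ { zero → refl ; (suc zero) → refl ; (suc (suc i)) → refl }) ⟩
    y * detK 1 t (x ∷ d) + detK 1 (suc t) (x ∷ 0# ∷ d)
      ∎
    where
    B : ∀ {t} → Matrix (1 ℕ.+ t)
    B = blockOf (inFirstPart 1)
    d′ = (x ∷ y ∷ d) ∘ punchIn (suc zero)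
    d₀ = updateAt (x ∷ y ∷ d) (suc zero) (λ _ → 0#)

  detK-mergeSecond : ∀ t x y (d : Fin t → Carrier) →
    detK 1 (suc (suc t)) (x ∷ 0# ∷ y ∷ d) ≈ y * detK 1 (suc t) (x ∷ 0# ∷ d)
  detK-mergeSecond t x y d = begin
    detK 1 (suc (suc t)) (x ∷ 0# ∷ y ∷ d)
      ≈⟨ det-diagonal+-merge (suc zero) (x ∷ 0# ∷ y ∷ d) B refl (λ _ → refl) ⟩
    y * det R (suc (suc t)) (diagonal d′ +ᴹ minor (suc (suc zero)) (suc (suc zero)) B)
      ≈⟨ *-congˡ (det-diagonal+-cong d′ (x ∷ 0# ∷ d) (minor (suc (suc zero)) (suc (suc zero)) B) B
                   (λ { zero → refl ; (suc zero) → refl ; (suc (suc i)) → refl })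
                   (minor-blockOf (suc (suc zero)) (inFirstPart 1) (inFirstPart 1)
                     λ { zero → ≡.refl ; (suc zero) → ≡.refl ; (suc (suc a)) → ≡.refl })) ⟩
    y * detK 1 (suc t) (x ∷ 0# ∷ d)
      ∎
    where
    B : ∀ {t} → Matrix (1 ℕ.+ t)
    B = blockOf (inFirstPart 1)
    d′ = (x ∷ 0# ∷ y ∷ d) ∘ punchIn (suc (suc zero))

  detK-1-1 : ∀ x y (d : Fin 0 → Carrier) → detK 1 1 (x ∷ y ∷ d) ≈ (x + p) * (y + p) - 1#
  detK-1-1 x y d = trans (det-2×2 (diagonal (x ∷ y ∷ d) +ᴹ blockOf (inFirstPart 1)))
    (solve 3 (λ x y q → let p′ = q :+ con (+ 1) in
                (x :+ p′) :* (y :+ p′) :- (con (+ 0) :+ con (+ 1)) :* (con (+ 0) :+ con (+ 1))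
                := (x :+ p′) :* (y :+ p′) :- con (+ 1))
             refl x y q)

  detK-reduceFirstPart : ∀ s t → detK (suc s) t δs ≈ pow R δ s * (detK 1 t δs + fromℕ R s * detK 1 t (0# ∷ δs))
  detK-reduceFirstPart s t = geometricallyForced-closedForm δ f g stepᶠ stepᵍ s
    where
    f g : ℕ → Carrier
    f n = detK (suc n) t δs
    g n = detK (suc n) t (0# ∷ δs)
    stepᶠ : ∀ n → f (suc n) ≈ δ * f n + g (suc n)
    stepᶠ n = trans (detK-cong (suc (suc n)) t δs (δ ∷ δs) λ { zero → refl ; (suc i) → refl })
                    (detK-peelFirst (suc n) t δ δs)
    stepᵍ : ∀ n → g (suc n) ≈ δ * g n
    stepᵍ n = trans (detK-cong (suc (suc n)) t (0# ∷ δs) (0# ∷ δ ∷ δs)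
                       λ { zero → refl ; (suc zero) → refl ; (suc (suc i)) → refl })
                    (detK-mergeFirst n t δ δs)

  detK-star : ∀ t x → detK 1 (suc t) (x ∷ δs) ≈ pow R δ t * (fromℕ R t * ((x + p) * p - 1#) - 1#)
  detK-star t x = begin
    f t
      ≈⟨ geometricallyForced-closedForm δ f g stepᶠ stepᵍ t ⟩
    pow R δ t * (f 0 + fromℕ R t * g 0)
      ≈⟨ *-congˡ (+-cong f₀ (*-congˡ (detK-1-1 x 0# δs))) ⟩
    pow R δ t * ((x + p) * (δ + p) - 1# + fromℕ R t * ((x + p) * (0# + p) - 1#))
      ≈⟨ *-congˡ (solve 3 (λ x n q → let p′ = q :+ con (+ 1) in
                   (x :+ p′) :* (:- p′ :+ p′) :- con (+ 1) :+ n :* ((x :+ p′) :* (con (+ 0) :+ p′) :- con (+ 1))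
                   := n :* ((x :+ p′) :* p′ :- con (+ 1)) :- con (+ 1))
                 refl x (fromℕ R t) q) ⟩
    pow R δ t * (fromℕ R t * ((x + p) * p - 1#) - 1#)
      ∎
    where
    f g : ℕ → Carrier
    f n = detK 1 (suc n) (x ∷ δs)
    g n = detK 1 (suc n) (x ∷ 0# ∷ δs)
    stepᶠ : ∀ n → f (suc n) ≈ δ * f n + g (suc n)
    stepᶠ n = trans (detK-cong 1 (suc (suc n)) (x ∷ δs) (x ∷ δ ∷ δs)
                       λ { zero → refl ; (suc zero) → refl ; (suc (suc i)) → refl })
                    (detK-peelSecond (suc n) x δ δs)
    stepᵍ : ∀ n → g (suc n) ≈ δ * g n
    stepᵍ n = trans (detK-cong 1 (suc (suc n)) (x ∷ 0# ∷ δs) (x ∷ 0# ∷ δ ∷ δs)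
                       λ { zero → refl ; (suc zero) → refl ; (suc (suc zero)) → refl ; (suc (suc (suc i))) → refl })
                    (detK-mergeSecond n x δ δs)
    f₀ : f 0 ≈ (x + p) * (δ + p) - 1#
    f₀ = trans (detK-cong 1 1 (x ∷ δs) (x ∷ δ ∷ δs) λ { zero → refl ; (suc zero) → refl })
               (detK-1-1 x δ δs)

  pow≡^ : ∀ x n → pow R x n ≡ x ^ n
  pow≡^ x zero    = ≡.refl
  pow≡^ x (suc n) = ≡.cong (x *_) (pow≡^ x n)

  powδ-+ : ∀ m n → pow R δ m * pow R δ n ≈ pow R (- 1#) (m ℕ.+ n) * pow R p (m ℕ.+ n)
  powδ-+ m n = begin
    pow R δ m * pow R δ n          ≡⟨ ≡.cong₂ _*_ (pow≡^ δ m) (pow≡^ δ n) ⟩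
    δ ^ m * δ ^ n                  ≈⟨ ^-homo-* δ m n ⟨
    δ ^ k                          ≈⟨ ^-congˡ k (-1*x≈-x p) ⟨
    (- 1# * p) ^ k                 ≈⟨ ^-distrib-* (- 1#) p k ⟩
    (- 1#) ^ k * p ^ k             ≡⟨ ≡.cong₂ _*_ (pow≡^ (- 1#) k) (pow≡^ p k) ⟨
    pow R (- 1#) k * pow R p k     ∎
    where k = m ℕ.+ n

  det-qDistK : ∀ s t → det R (suc s ℕ.+ suc t) (qDistK R (suc s) (suc t) q)
    ≈ pow R (- 1#) (s ℕ.+ t) * pow R p (s ℕ.+ t)
      * (pow R p 2 * fromℕ R s * fromℕ R t - fromℕ R (suc s) * fromℕ R (suc t))
  det-qDistK s t = begin
    det R (suc s ℕ.+ suc t) (qDistK R (suc s) (suc t) q)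
      ≈⟨ det-cong (suc s ℕ.+ suc t) (qDistK≈diagonal+block (suc s) (suc t)) ⟩
    detK (suc s) (suc t) δs
      ≈⟨ detK-reduceFirstPart s (suc t) ⟩
    pow R δ s * (detK 1 (suc t) δs + S * detK 1 (suc t) (0# ∷ δs))
      ≈⟨ *-congˡ (+-cong (trans (detK-cong 1 (suc t) δs (δ ∷ δs) λ { zero → refl ; (suc i) → refl })
                                (detK-star t δ))
                         (*-congˡ (detK-star t 0#))) ⟩
    pow R δ s * (pow R δ t * (T * ((δ + p) * p - 1#) - 1#) + S * (pow R δ t * (T * ((0# + p) * p - 1#) - 1#)))
      ≈⟨ solve 5 (λ P Q S T q → let p′ = q :+ con (+ 1) in
           P :* (Q :* (T :* ((:- p′ :+ p′) :* p′ :- con (+ 1)) :- con (+ 1))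
                 :+ S :* (Q :* (T :* ((con (+ 0) :+ p′) :* p′ :- con (+ 1)) :- con (+ 1))))
           := P :* Q :* (p′ :* (p′ :* con (+ 1)) :* S :* T :- (con (+ 1) :+ S) :* (con (+ 1) :+ T)))
         refl (pow R δ s) (pow R δ t) S T q ⟩
    pow R δ s * pow R δ t * (pow R p 2 * S * T - fromℕ R (suc s) * fromℕ R (suc t))
      ≈⟨ *-congʳ (powδ-+ s t) ⟩
    pow R (- 1#) (s ℕ.+ t) * pow R p (s ℕ.+ t) * (pow R p 2 * S * T - fromℕ R (suc s) * fromℕ R (suc t))
      ∎
    where
    S = fromℕ R s
    T = fromℕ R t

theorem3p1 : ∀ {c ℓ : Level} (R : CommutativeRing c ℓ) (s t : ℕ) → 1 ≤ s → 1 ≤ t →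
  let open CommutativeRing R in
  (q : Carrier) → ¬ (q + 1# ≈ 0#) →
  det R (s Data.Nat.+ t) (qDistK R s t q)
    ≈ pow R (- 1#) ((s Data.Nat.+ t) ∸ 2) * pow R (q + 1#) ((s Data.Nat.+ t) ∸ 2)
      * ((pow R (q + 1#) 2 * fromℕ R (s ∸ 1) * fromℕ R (t ∸ 1)) - fromℕ R s * fromℕ R t)
theorem3p1 R (suc s) (suc t) _ _ q _ rewrite ≡.cong (_∸ 1) (ℕ.+-suc s t) =
  CompleteBipartite.det-qDistK R q s t
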